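{- Let $p$ be a prime and let $\Gamma=\mathbb{Z}_{p^{\beta}}\oplus \mathbb{Z}_{p^{\gamma}}$ where $1\leq\beta\leq\gamma$ are integers with $\beta+\gamma=2\alpha$ and $|\Gamma|=p^{2\alpha}>4$. Then there exists a $\Gamma$-magic square $\mathrm{MS}_{\Gamma}(p^\alpha)$ of side $p^\alpha$.
   Context: For an Abelian group $(\Gamma,+)$ of order $n^2$, a $\Gamma$-magic square $\mathrm{MS}_{\Gamma}(n)$ (of side $n$) is an $n\times n$ array whose entries are all the elements of $\Gamma$ (each element appearing exactly once) such that all row sums, all column sums, the sum along the main diagonal and the sum along the backward main diagonal are equal to the same element $\mu\in\Gamma$. $\mathbb{Z}_r$ denotes the cyclic group of order $r$. -}

module Defs where

open import Data.Nat using (ℕ; zero; suc; _^_; NonZero)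
import Data.Nat as ℕ
open import Data.Nat.DivMod using (_mod_)
open import Data.Fin using (Fin; toℕ; fromℕ; opposite)
import Data.Fin as F
open import Data.Product using (_×_; _,_; proj₁; proj₂; Σ; ∃)
open import Relation.Binary.PropositionalEquality using (_≡_)
open import Function.Definitions using (Bijective)

ZZ : ℕ → ℕ → Set
ZZ m k = Fin m × Fin k

addZZ : (m k : ℕ) .{{_ : NonZero m}} .{{_ : NonZero k}} → ZZ m k → ZZ m k → ZZ m k
addZZ m k (a , b) (c , d) = ((toℕ a ℕ.+ toℕ c) mod m) , ((toℕ b ℕ.+ toℕ d) mod k)

zeroZZ : (m k : ℕ) .{{_ : NonZero m}} .{{_ : NonZero k}} → ZZ m k
zeroZZ m k = (0 mod m) , (0 mod k)

sumZZ : (m k : ℕ) .{{_ : NonZero m}} .{{_ : NonZero k}} → (n : ℕ) → (Fin n → ZZ m k) → ZZ m k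
sumZZ m k zero    f = zeroZZ m k
sumZZ m k (suc n) f = addZZ m k (f F.zero) (sumZZ m k n (λ i → f (F.suc i)))

record IsMagicSquare (m k : ℕ) .{{_ : NonZero m}} .{{_ : NonZero k}} (n : ℕ)
                     (A : Fin n → Fin n → ZZ m k) : Set where
  field
    bij      : Bijective _≡_ _≡_ (λ (ij : Fin n × Fin n) → A (proj₁ ij) (proj₂ ij))
    μ        : ZZ m k
    rows     : ∀ i → sumZZ m k n (λ j → A i j) ≡ μ
    cols     : ∀ j → sumZZ m k n (λ i → A i j) ≡ μ
    diag     : sumZZ m k n (λ i → A i i) ≡ μ
    antidiag : sumZZ m k n (λ i → A i (opposite i)) ≡ μ

MagicSquare : (m k : ℕ) .{{_ : NonZero m}} .{{_ : NonZero k}} (n : ℕ) → Set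
MagicSquare m k n = Σ (Fin n → Fin n → ZZ m k) (IsMagicSquare m k n)

-- Write n = p^α, m = p^β and r = p^(α-β), so that n = r m and p^γ = r n.  The map
-- (i, j) ↦ U i + V j with U i = (0, i r) and V j = (j, ⌊j / m⌋) is a bijection
-- [0, n)² → Z_m ⊕ Z_(rn), and both U and V are complementary: U i + U (n-1-i) and
-- V j + V (n-1-j) do not depend on i, j.  It therefore suffices to place every digit
-- pair (i, j) once in an n × n array so that along each line the U-digits and the
-- V-digits sum as they do over a full set of digits.
--
-- For n odd (p odd) the affine digits (i + c - j, j + i + c′) mod n work: each line runs
-- through all residues, except that on each diagonal one digit is constantly the centre
-- (n-1)/2, whose n-fold sum equals the full sum by complementarity.  For 4 ∣ n (p = 2;
-- n = 2 is excluded by |Γ| > 4) the doubly even pattern works: reflect both digits of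
-- the cells off the diagonals of the 4 × 4 blocks, so that every line splits into
-- complementary pairs.

module Submission where

open import Level using (0ℓ)
open import Algebra.Bundles using (AbelianGroup; CommutativeMonoid)
import Algebra.Properties.CommutativeMonoid.Sum as Sum
import Algebra.Properties.CommutativeMonoid.Mult as Mult
open import Data.Bool using (Bool; true; false; not; _xor_; if_then_else_)
open import Data.Bool.Properties using (xor-same; not-distribˡ-xor; not-distribʳ-xor)
open import Data.Nat using (ℕ; zero; suc; pred; _+_; _*_; _^_; _∸_; _<_; _≤_; NonZero; z<s; s<s; s≤s; s≤s⁻¹)
import Data.Nat.Properties as ℕ
open import Data.Nat.DivMod
open import Data.Nat.Tactic.RingSolver using (solve-∀)
open import Data.Fin using (Fin; toℕ; fromℕ; fromℕ<; opposite)
open import Data.Fin.Patterns using (0F; 1F; 2F; 3F)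
open import Data.Fin.Permutation using (permutation)
open import Data.Fin.Properties using (toℕ-injective; toℕ-fromℕ; toℕ-fromℕ<; toℕ<n; opposite-prop; opposite-involutive)
open import Data.Nat.Primality using (Prime; prime⇒nonZero; prime⇒irreducible)
open import Data.Nat.Properties using (m^n≢0)
open import Data.Nat.Divisibility using (n∣m*n; m%n≡0⇒n∣m)
open import Data.Product using (_×_; _,_; proj₁; proj₂; ∃-syntax)
open import Data.Sum using (_⊎_; inj₁; inj₂)
open import Relation.Nullary.Negation using (contradiction)
open import Function.Base using (_∘_)
open import Function.Bundles using (mk↔ₛ′)
import Function.Bundles as Bundles
import Function.Construct.Composition as Composition
open import Function.Definitions using (Bijective; StrictlyInverseˡ; StrictlyInverseʳ)
open import Function.Properties.Inverse using (Inverse⇒Bijection)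
open import Relation.Binary.PropositionalEquality hiding (J)
open import Defs

reverse-involutive : ∀ {x n} → x < n → n ∸ suc (n ∸ suc x) ≡ x
reverse-involutive {n = suc n} (s≤s x≤n) = ℕ.m∸[m∸n]≡n x≤n

+-reverse : ∀ {x n} → x < n → x + (n ∸ suc x) ≡ pred n
+-reverse x<n = cong pred (ℕ.m+[n∸m]≡n x<n)

∸-suc< : ∀ {x m} → x < m → m ∸ suc x < m
∸-suc< x<m = ℕ.∸-monoʳ-< z<s x<m

m<n⇒[m+kn]%n≡m : ∀ {a d} q .{{_ : NonZero d}} → a < d → (a + q * d) % d ≡ a
m<n⇒[m+kn]%n≡m {a} {d} q a<d = trans ([m+kn]%n≡m%n a q d) (m<n⇒m%n≡m a<d)

m<n⇒[m+kn]/n≡k : ∀ {a d} q .{{_ : NonZero d}} → a < d → (a + q * d) / d ≡ q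
m<n⇒[m+kn]/n≡k {a} {d} q a<d = trans (+-distrib-/-∣ʳ a (n∣m*n q)) (cong₂ _+_ (m<n⇒m/n≡0 a<d) (m*n/n≡m q d))

[m%n*o]%n≡[m*o]%n : ∀ a b n .{{_ : NonZero n}} → (a % n * b) % n ≡ (a * b) % n
[m%n*o]%n≡[m*o]%n a b n = begin
  (a % n * b) % n             ≡⟨ %-distribˡ-* (a % n) b n ⟩
  (a % n % n * (b % n)) % n   ≡⟨ cong (λ x → (x * (b % n)) % n) (m%n%n≡m%n a n) ⟩
  (a % n * (b % n)) % n       ≡⟨ %-distribˡ-* a b n ⟨
  (a * b) % n                 ∎
  where open ≡-Reasoning

reverse-digits : ∀ {m r n y} .{{_ : NonZero m}} → n ≡ r * m → y < n →
                 n ∸ suc y ≡ (m ∸ suc (y % m)) + (r ∸ suc (y / m)) * m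
reverse-digits {m} {r} {n} {y} refl y<n = begin
  r * m ∸ suc y                                  ≡⟨ cong (_∸ suc y) r*m≡ ⟩
  (m ∸ suc s) + (r ∸ suc q) * m + suc y ∸ suc y  ≡⟨ ℕ.m+n∸n≡m _ (suc y) ⟩
  (m ∸ suc s) + (r ∸ suc q) * m                  ∎
  where
  open ≡-Reasoning
  s q : ℕ
  s = y % m
  q = y / m
  distribute : ∀ s s′ q q′ → (suc q + q′) * (suc s + s′) ≡ (s′ + q′ * (suc s + s′)) + suc (s + q * (suc s + s′))
  distribute = solve-∀
  r*m≡ : r * m ≡ (m ∸ suc s) + (r ∸ suc q) * m + suc y
  r*m≡ = begin
    r * m                                                ≡⟨ cong₂ _*_ (ℕ.m+[n∸m]≡n (m<n*o⇒m/o<n {n = r} y<n)) (ℕ.m+[n∸m]≡n (m%n<n y m)) ⟨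
    (suc q + (r ∸ suc q)) * (suc s + (m ∸ suc s))        ≡⟨ distribute s (m ∸ suc s) q (r ∸ suc q) ⟩
    _                                                    ≡⟨ cong (λ m′ → (m ∸ suc s) + (r ∸ suc q) * m′ + suc (s + q * m′)) (ℕ.m+[n∸m]≡n (m%n<n y m)) ⟩
    (m ∸ suc s) + (r ∸ suc q) * m + suc (s + q * m)      ≡⟨ cong (λ y′ → (m ∸ suc s) + (r ∸ suc q) * m + suc y′) (m≡m%n+[m/n]*n y m) ⟨
    (m ∸ suc s) + (r ∸ suc q) * m + suc y                ∎

%-reverse : ∀ {m r n y} .{{_ : NonZero m}} → n ≡ r * m → y < n → (n ∸ suc y) % m ≡ m ∸ suc (y % m)
%-reverse {m} {r} {y = y} n≡r*m y<n =
  trans (cong (_% m) (reverse-digits {r = r} n≡r*m y<n)) (m<n⇒[m+kn]%n≡m (r ∸ suc (y / m)) (∸-suc< (m%n<n y m)))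

/-reverse : ∀ {m r n y} .{{_ : NonZero m}} → n ≡ r * m → y < n → (n ∸ suc y) / m ≡ r ∸ suc (y / m)
/-reverse {m} {r} {y = y} n≡r*m y<n =
  trans (cong (_/ m) (reverse-digits {r = r} n≡r*m y<n)) (m<n⇒[m+kn]/n≡k (r ∸ suc (y / m)) (∸-suc< (m%n<n y m)))

bijective-inverse : ∀ {A B : Set} (f : A → B) (g : B → A) →
                    StrictlyInverseˡ _≡_ f g → StrictlyInverseʳ _≡_ f g → Bijective _≡_ _≡_ f
bijective-inverse f g fg gf = Bundles.Bijection.bijective (Inverse⇒Bijection (mk↔ₛ′ f g fg gf))

module ComplementarySums {c ℓ} (M : CommutativeMonoid c ℓ) where

  module M = CommutativeMonoid M
  open M using (Carrier; _≈_; _∙_; ∙-cong; ∙-congˡ; ∙-congʳ; assoc; comm; identityˡ; identityʳ) renaming (ε to 0#)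
  open Sum M using (sum; sum-permute)
  open Mult M using (×-homo-+; ×-distrib-+; ×-congˡ; ×-congʳ) renaming (_×_ to _·_)
  open import Algebra.Properties.CommutativeSemigroup M.commutativeSemigroup using (x∙yz≈xz∙y)
  open import Relation.Binary.Reasoning.Setoid M.setoid

  sumℕ : ℕ → (ℕ → Carrier) → Carrier
  sumℕ n f = sum {n} (λ i → f (toℕ i))

  Complementary : ℕ → Carrier → (ℕ → Carrier) → Set ℓ
  Complementary n K f = ∀ i → i < n → f i ∙ f (n ∸ suc i) ≈ K

  sumℕ-snoc : ∀ n f → sumℕ (suc n) f ≈ sumℕ n f ∙ f n
  sumℕ-snoc zero    f = M.trans (identityʳ (f 0)) (M.sym (identityˡ (f 0)))
  sumℕ-snoc (suc n) f = M.trans (∙-congˡ (sumℕ-snoc n (f ∘ suc))) (M.sym (assoc _ _ _))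

  sumℕ-ends : ∀ n f → sumℕ (suc (suc n)) f ≈ (f 0 ∙ f (suc n)) ∙ sumℕ n (f ∘ suc)
  sumℕ-ends n f = M.trans (∙-congˡ (sumℕ-snoc n (f ∘ suc))) (x∙yz≈xz∙y _ _ _)

  complementary-inner : ∀ {n K f} → Complementary (suc (suc n)) K f → Complementary n K (f ∘ suc)
  complementary-inner {n} {K} {f} c i i<n = begin
    f (suc i) ∙ f (suc (n ∸ suc i)) ≡⟨ cong (λ j → f (suc i) ∙ f j) (sym (ℕ.+-∸-assoc 1 i<n)) ⟩
    f (suc i) ∙ f (n ∸ i)           ≈⟨ c (suc i) (s<s (ℕ.m<n⇒m<1+n i<n)) ⟩
    K                               ∎

  complementary-sum-even : ∀ h {K} f → Complementary (h * 2) K f → sumℕ (h * 2) f ≈ h · K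
  complementary-sum-even zero    f _ = M.refl
  complementary-sum-even (suc h) {K} f c = begin
    sumℕ (suc h * 2) f                               ≈⟨ sumℕ-ends (h * 2) f ⟩
    (f 0 ∙ f (suc (h * 2))) ∙ sumℕ (h * 2) (f ∘ suc) ≈⟨ ∙-cong (c 0 z<s) (complementary-sum-even h (f ∘ suc) (complementary-inner c)) ⟩
    K ∙ h · K                                        ∎

  complementary-sum-odd : ∀ h {K} f → Complementary (suc (h * 2)) K f → sumℕ (suc (h * 2)) f ≈ h · K ∙ f h
  complementary-sum-odd zero    f _ = comm (f 0) 0#
  complementary-sum-odd (suc h) {K} f c = begin
    sumℕ (suc (suc h * 2)) f                                   ≈⟨ sumℕ-ends (suc (h * 2)) f ⟩
    (f 0 ∙ f (suc (suc (h * 2)))) ∙ sumℕ (suc (h * 2)) (f ∘ suc) ≈⟨ ∙-cong (c 0 z<s) (complementary-sum-odd h (f ∘ suc) (complementary-inner c)) ⟩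
    K ∙ (h · K ∙ f (suc h))                                    ≈⟨ M.sym (assoc _ _ _) ⟩
    suc h · K ∙ f (suc h)                                      ∎

  complementary-sum-centre : ∀ h {K} f → Complementary (suc (h * 2)) K f → sumℕ (suc (h * 2)) f ≈ suc (h * 2) · f h
  complementary-sum-centre h {K} f c = begin
    sumℕ (suc (h * 2)) f          ≈⟨ complementary-sum-odd h f c ⟩
    h · K ∙ f h                   ≈⟨ ∙-congʳ (×-congʳ h (M.sym centre)) ⟩
    h · (f h ∙ f h) ∙ f h         ≈⟨ ∙-congʳ (×-distrib-+ (f h) (f h) h) ⟩
    (h · f h ∙ h · f h) ∙ f h     ≈⟨ ∙-congʳ (M.sym (×-homo-+ (f h) h h)) ⟩
    (h + h) · f h ∙ f h           ≈⟨ comm _ _ ⟩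
    f h ∙ (h + h) · f h           ≈⟨ ∙-congˡ (×-congˡ (h+h≡h*2)) ⟩
    suc (h * 2) · f h             ∎
    where
    h+h≡h*2 : h + h ≡ h * 2
    h+h≡h*2 = trans (cong (h +_) (sym (ℕ.+-identityʳ h))) (ℕ.*-comm 2 h)
    centre : f h ∙ f h ≈ K
    centre = M.trans (M.reflexive (cong (λ x → f h ∙ f x) (trans (sym (ℕ.m+n∸m≡n h h)) (cong (_∸ h) h+h≡h*2)))) (c h (s≤s (ℕ.m≤m*n h 2)))

  complementary-reflectIf : ∀ {n K} f (b : ℕ → Bool) → (∀ x → x < n → b (n ∸ suc x) ≡ b x) →
                            Complementary n K f → Complementary n K (λ x → f (if b x then n ∸ suc x else x))
  complementary-reflectIf {n} {K} f b b-reverse c x x<n rewrite b-reverse x x<n with b x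
  ... | true  = M.trans (∙-congˡ (M.reflexive (cong f (reverse-involutive x<n)))) (M.trans (comm _ _) (c x x<n))
  ... | false = c x x<n

  sumℕ-pairs : ∀ h {K} f → (∀ q → q < h → f (q * 2) ∙ f (suc (q * 2)) ≈ K) → sumℕ (h * 2) f ≈ h · K
  sumℕ-pairs zero    f _ = M.refl
  sumℕ-pairs (suc h) {K} f pair = begin
    f 0 ∙ (f 1 ∙ sumℕ (h * 2) (f ∘ suc ∘ suc)) ≈⟨ M.sym (assoc _ _ _) ⟩
    (f 0 ∙ f 1) ∙ sumℕ (h * 2) (f ∘ suc ∘ suc) ≈⟨ ∙-cong (pair 0 z<s) (sumℕ-pairs h (f ∘ suc ∘ suc) (λ q q<h → pair (suc q) (s<s q<h))) ⟩
    K ∙ h · K                                  ∎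

  sum-∘-invertible : ∀ {n} (f : Fin n → Carrier) (π π⁻¹ : Fin n → Fin n) →
                     StrictlyInverseˡ _≡_ π π⁻¹ → StrictlyInverseʳ _≡_ π π⁻¹ → sum (f ∘ π) ≈ sum f
  sum-∘-invertible f π π⁻¹ l r = M.sym (sum-permute f (permutation π π⁻¹ l r))

module Modular (n : ℕ) .{{_ : NonZero n}} where

  infixl 6 _+ₙ_
  _+ₙ_ : Fin n → Fin n → Fin n
  a +ₙ b = (toℕ a + toℕ b) mod n

  0ₙ : Fin n
  0ₙ = 0 mod n

  -ₙ_ : Fin n → Fin n
  -ₙ a = (n ∸ toℕ a) mod n

  toℕ-mod : ∀ x → toℕ (x mod n) ≡ x % n
  toℕ-mod x = toℕ-fromℕ< (m%n<n x n)

  mod-toℕ : ∀ a → toℕ a mod n ≡ a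
  mod-toℕ a = toℕ-injective (trans (toℕ-mod (toℕ a)) (m<n⇒m%n≡m (toℕ<n a)))

  %≡toℕ⇒mod≡ : ∀ x {a} → x % n ≡ toℕ a → x mod n ≡ a
  %≡toℕ⇒mod≡ x eq = toℕ-injective (trans (toℕ-mod x) eq)

  mod-+ : ∀ x y → (x + y) mod n ≡ x mod n +ₙ y mod n
  mod-+ x y = toℕ-injective (begin
    toℕ ((x + y) mod n)                    ≡⟨ toℕ-mod (x + y) ⟩
    (x + y) % n                            ≡⟨ %-distribˡ-+ x y n ⟩
    (x % n + y % n) % n                    ≡⟨ cong₂ (λ a b → (a + b) % n) (toℕ-mod x) (toℕ-mod y) ⟨
    (toℕ (x mod n) + toℕ (y mod n)) % n    ≡⟨ toℕ-mod _ ⟨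
    toℕ (x mod n +ₙ y mod n)               ∎)
    where open ≡-Reasoning

  +ₙ-assoc : ∀ a b c → (a +ₙ b) +ₙ c ≡ a +ₙ (b +ₙ c)
  +ₙ-assoc a b c = begin
    (a +ₙ b) +ₙ c                         ≡⟨ cong ((a +ₙ b) +ₙ_) (mod-toℕ c) ⟨
    (toℕ a + toℕ b) mod n +ₙ toℕ c mod n  ≡⟨ mod-+ (toℕ a + toℕ b) (toℕ c) ⟨
    (toℕ a + toℕ b + toℕ c) mod n         ≡⟨ cong (_mod n) (ℕ.+-assoc (toℕ a) (toℕ b) (toℕ c)) ⟩
    (toℕ a + (toℕ b + toℕ c)) mod n       ≡⟨ mod-+ (toℕ a) (toℕ b + toℕ c) ⟩
    toℕ a mod n +ₙ (b +ₙ c)               ≡⟨ cong (_+ₙ (b +ₙ c)) (mod-toℕ a) ⟩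
    a +ₙ (b +ₙ c)                         ∎
    where open ≡-Reasoning

  +ₙ-comm : ∀ a b → a +ₙ b ≡ b +ₙ a
  +ₙ-comm a b = cong (_mod n) (ℕ.+-comm (toℕ a) (toℕ b))

  +ₙ-identityˡ : ∀ a → 0ₙ +ₙ a ≡ a
  +ₙ-identityˡ a = begin
    0ₙ +ₙ a              ≡⟨ cong (0ₙ +ₙ_) (mod-toℕ a) ⟨
    0ₙ +ₙ toℕ a mod n    ≡⟨ mod-+ 0 (toℕ a) ⟨
    toℕ a mod n          ≡⟨ mod-toℕ a ⟩
    a                    ∎
    where open ≡-Reasoning

  +ₙ-inverseʳ : ∀ a → a +ₙ -ₙ a ≡ 0ₙ
  +ₙ-inverseʳ a = begin
    a +ₙ -ₙ a                          ≡⟨ cong (_+ₙ -ₙ a) (mod-toℕ a) ⟨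
    toℕ a mod n +ₙ (n ∸ toℕ a) mod n  ≡⟨ mod-+ (toℕ a) (n ∸ toℕ a) ⟨
    (toℕ a + (n ∸ toℕ a)) mod n        ≡⟨ cong (_mod n) (ℕ.m+[n∸m]≡n (ℕ.<⇒≤ (toℕ<n a))) ⟩
    n mod n                            ≡⟨ %≡toℕ⇒mod≡ n (trans ([m+n]%n≡m%n 0 n) (sym (toℕ-mod 0))) ⟩
    0ₙ                                 ∎
    where open ≡-Reasoning

ℤ/_ : (n : ℕ) .{{_ : NonZero n}} → AbelianGroup 0ℓ 0ℓ
ℤ/ n = record
  { Carrier = Fin n ; _≈_ = _≡_ ; _∙_ = _+ₙ_ ; ε = 0ₙ ; _⁻¹ = -ₙ_
  ; isAbelianGroup = record
    { isGroup = record
      { isMonoid = record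
        { isSemigroup = record { isMagma = record { isEquivalence = isEquivalence ; ∙-cong = cong₂ _+ₙ_ } ; assoc = +ₙ-assoc }
        ; identity = +ₙ-identityˡ , λ a → trans (+ₙ-comm a 0ₙ) (+ₙ-identityˡ a) }
      ; inverse = (λ a → trans (+ₙ-comm (-ₙ a) a) (+ₙ-inverseʳ a)) , +ₙ-inverseʳ
      ; ⁻¹-cong = cong -ₙ_ }
    ; comm = +ₙ-comm } }
  where open Modular n

ZZ-commutativeMonoid : (m k : ℕ) .{{_ : NonZero m}} .{{_ : NonZero k}} → CommutativeMonoid 0ℓ 0ℓ
ZZ-commutativeMonoid m k = record
  { Carrier = ZZ m k ; _≈_ = _≡_ ; _∙_ = addZZ m k ; ε = zeroZZ m k
  ; isCommutativeMonoid = record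
    { isMonoid = record
      { isSemigroup = record
        { isMagma = record { isEquivalence = isEquivalence ; ∙-cong = cong₂ (addZZ m k) }
        ; assoc = λ (a , b) (c , d) (e , f) → cong₂ _,_ (ℤₘ.assoc a c e) (ℤₖ.assoc b d f) }
      ; identity = (λ (a , b) → cong₂ _,_ (ℤₘ.identityˡ a) (ℤₖ.identityˡ b))
                 , (λ (a , b) → cong₂ _,_ (ℤₘ.identityʳ a) (ℤₖ.identityʳ b)) }
    ; comm = λ (a , b) (c , d) → cong₂ _,_ (ℤₘ.comm a c) (ℤₖ.comm b d) } }
  where
  module ℤₘ = AbelianGroup (ℤ/ m)
  module ℤₖ = AbelianGroup (ℤ/ k)

sumZZ≡sum : ∀ (m k : ℕ) .{{_ : NonZero m}} .{{_ : NonZero k}} n (f : Fin n → ZZ m k) →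
            sumZZ m k n f ≡ Sum.sum (ZZ-commutativeMonoid m k) f
sumZZ≡sum m k zero    f = refl
sumZZ≡sum m k (suc n) f = cong (addZZ m k (f Fin.zero)) (sumZZ≡sum m k n (f ∘ Fin.suc))

data Line (n : ℕ) : Set where
  row col                : Fin n → Line n
  diagonal antidiagonal  : Line n

cell : ∀ {n} → Line n → Fin n → Fin n × Fin n
cell (row i)      t = i , t
cell (col j)      t = t , j
cell diagonal     t = t , t
cell antidiagonal t = t , opposite t

isMagicSquare-lines : ∀ (m k : ℕ) .{{_ : NonZero m}} .{{_ : NonZero k}} n (A : Fin n → Fin n → ZZ m k) →
                      Bijective _≡_ _≡_ (λ (ij : Fin n × Fin n) → A (proj₁ ij) (proj₂ ij)) → (μ : ZZ m k) →
                      (∀ ℓ → sumZZ m k n (λ t → A (proj₁ (cell ℓ t)) (proj₂ (cell ℓ t))) ≡ μ) →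
                      IsMagicSquare m k n A
isMagicSquare-lines m k n A bij μ lines = record
  { bij = bij ; μ = μ
  ; rows = λ i → lines (row i) ; cols = λ j → lines (col j)
  ; diag = lines diagonal ; antidiag = lines antidiagonal }

module Encoding (m k n r : ℕ) .{{_ : NonZero m}} .{{_ : NonZero k}} .{{_ : NonZero r}}
                (n≡r*m : n ≡ r * m) (k≡r*n : k ≡ r * n) where

  G : CommutativeMonoid 0ℓ 0ℓ
  G = ZZ-commutativeMonoid m k

  open CommutativeMonoid G using (_∙_)
  open Sum G using (sum; ∑-distrib-+)
  open ComplementarySums G using (Complementary)

  toZZ : ℕ → ℕ → ZZ m k
  toZZ x y = x mod m , y mod k

  toZZ-+ : ∀ x y x′ y′ → toZZ (x + x′) (y + y′) ≡ toZZ x y ∙ toZZ x′ y′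
  toZZ-+ x y x′ y′ = cong₂ _,_ (Modular.mod-+ m x x′) (Modular.mod-+ k y y′)

  U V : ℕ → ZZ m k
  U x = toZZ 0 (x * r)
  V y = toZZ y (y / m)

  Kᵁ Kⱽ : ZZ m k
  Kᵁ = toZZ 0 (pred n * r)
  Kⱽ = toZZ (pred n) (pred r)

  U-complementary : Complementary n Kᵁ U
  U-complementary x x<n = begin
    U x ∙ U (n ∸ suc x)                ≡⟨ toZZ-+ 0 (x * r) 0 ((n ∸ suc x) * r) ⟨
    toZZ 0 (x * r + (n ∸ suc x) * r)   ≡⟨ cong (toZZ 0) (ℕ.*-distribʳ-+ r x (n ∸ suc x)) ⟨
    toZZ 0 ((x + (n ∸ suc x)) * r)     ≡⟨ cong (λ z → toZZ 0 (z * r)) (+-reverse x<n) ⟩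
    toZZ 0 (pred n * r)                ∎
    where open ≡-Reasoning

  quotient<r : ∀ {y} → y < n → y / m < r
  quotient<r y<n = m<n*o⇒m/o<n (subst (_ <_) n≡r*m y<n)

  V-complementary : Complementary n Kⱽ V
  V-complementary y y<n = begin
    V y ∙ V (n ∸ suc y)                                ≡⟨ toZZ-+ y (y / m) (n ∸ suc y) ((n ∸ suc y) / m) ⟨
    toZZ (y + (n ∸ suc y)) (y / m + (n ∸ suc y) / m)   ≡⟨ cong₂ toZZ (+-reverse y<n) (cong (y / m +_) (/-reverse {r = r} n≡r*m y<n)) ⟩
    toZZ (pred n) (y / m + (r ∸ suc (y / m)))          ≡⟨ cong (toZZ (pred n)) (+-reverse (quotient<r y<n)) ⟩
    toZZ (pred n) (pred r)                             ∎
    where open ≡-Reasoning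

  -- encode (i , j) = (j mod m , i r + ⌊j / m⌋): mixed radix, since ⌊j / m⌋ < r and i < n
  encode : Fin n × Fin n → ZZ m k
  encode (i , j) = U (toℕ i) ∙ V (toℕ j)

  encode≡toZZ : ∀ i j → encode (i , j) ≡ toZZ (toℕ j) (toℕ i * r + toℕ j / m)
  encode≡toZZ i j = sym (toZZ-+ 0 (toℕ i * r) (toℕ j) (toℕ j / m))

  high<n : ∀ (b : Fin k) → toℕ b / r < n
  high<n b = m<n*o⇒m/o<n (subst (toℕ b <_) (trans k≡r*n (ℕ.*-comm r n)) (toℕ<n b))

  low<n : ∀ (a : Fin m) (b : Fin k) → toℕ a + toℕ b % r * m < n
  low<n a b = begin-strict
    toℕ a + toℕ b % r * m  <⟨ ℕ.+-monoˡ-< (toℕ b % r * m) (toℕ<n a) ⟩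
    suc (toℕ b % r) * m    ≤⟨ ℕ.*-monoˡ-≤ m (m%n<n (toℕ b) r) ⟩
    r * m                  ≡⟨ n≡r*m ⟨
    n                      ∎
    where open ℕ.≤-Reasoning

  decode : ZZ m k → Fin n × Fin n
  decode (a , b) = fromℕ< (high<n b) , fromℕ< (low<n a b)

  code<k : ∀ (i j : Fin n) → toℕ j / m + toℕ i * r < k
  code<k i j = begin-strict
    toℕ j / m + toℕ i * r  <⟨ ℕ.+-monoˡ-< (toℕ i * r) (quotient<r (toℕ<n j)) ⟩
    suc (toℕ i) * r        ≤⟨ ℕ.*-monoˡ-≤ r (toℕ<n i) ⟩
    n * r                  ≡⟨ trans (ℕ.*-comm n r) (sym k≡r*n) ⟩
    k                      ∎
    where open ℕ.≤-Reasoning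

  decode-encode : ∀ ij → decode (encode ij) ≡ ij
  decode-encode (i , j) = begin
    decode (encode (i , j))   ≡⟨ cong decode (encode≡toZZ i j) ⟩
    decode (toZZ J c)         ≡⟨ cong₂ _,_ (toℕ-injective high) (toℕ-injective low) ⟩
    i , j                     ∎
    where
    open ≡-Reasoning
    J q c : ℕ
    J = toℕ j
    q = J / m
    c = toℕ i * r + q
    q<r : q < r
    q<r = quotient<r (toℕ<n j)
    c≡ : toℕ (c mod k) ≡ q + toℕ i * r
    c≡ = trans (Modular.toℕ-mod k c) (trans (cong (_% k) (ℕ.+-comm (toℕ i * r) q)) (m<n⇒m%n≡m (code<k i j)))
    high : toℕ (fromℕ< (high<n (c mod k))) ≡ toℕ i
    high = trans (toℕ-fromℕ< _) (trans (cong (_/ r) c≡) (m<n⇒[m+kn]/n≡k (toℕ i) q<r))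
    low : toℕ (fromℕ< (low<n (J mod m) (c mod k))) ≡ J
    low = begin
      toℕ (fromℕ< _)                          ≡⟨ toℕ-fromℕ< _ ⟩
      toℕ (J mod m) + toℕ (c mod k) % r * m   ≡⟨ cong₂ (λ x y → x + y % r * m) (Modular.toℕ-mod m J) c≡ ⟩
      J % m + (q + toℕ i * r) % r * m         ≡⟨ cong (λ x → J % m + x * m) (m<n⇒[m+kn]%n≡m (toℕ i) q<r) ⟩
      J % m + q * m                           ≡⟨ m≡m%n+[m/n]*n J m ⟨
      J                                       ∎

  encode-decode : ∀ ab → encode (decode ab) ≡ ab
  encode-decode (a , b) = begin
    encode (decode (a , b))                  ≡⟨ encode≡toZZ i j ⟩
    toZZ (toℕ j) (toℕ i * r + toℕ j / m)     ≡⟨ cong₂ _,_ (Modular.%≡toℕ⇒mod≡ m _ low) (Modular.%≡toℕ⇒mod≡ k _ high) ⟩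
    a , b                                    ∎
    where
    open ≡-Reasoning
    B : ℕ
    B = toℕ b
    i j : Fin n
    i = fromℕ< (high<n b)
    j = fromℕ< (low<n a b)
    j≡ : toℕ j ≡ toℕ a + B % r * m
    j≡ = toℕ-fromℕ< _
    low : toℕ j % m ≡ toℕ a
    low = trans (cong (_% m) j≡) (m<n⇒[m+kn]%n≡m (B % r) (toℕ<n a))
    high : (toℕ i * r + toℕ j / m) % k ≡ B
    high = begin
      (toℕ i * r + toℕ j / m) % k   ≡⟨ cong₂ (λ x y → (x * r + y) % k) (toℕ-fromℕ< (high<n b)) (trans (cong (_/ m) j≡) (m<n⇒[m+kn]/n≡k (B % r) (toℕ<n a))) ⟩
      (B / r * r + B % r) % k       ≡⟨ cong (_% k) (trans (ℕ.+-comm (B / r * r) (B % r)) (sym (m≡m%n+[m/n]*n B r))) ⟩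
      B % k                         ≡⟨ m<n⇒m%n≡m (toℕ<n b) ⟩
      B                             ∎

  encode-bijective : Bijective _≡_ _≡_ encode
  encode-bijective = bijective-inverse encode decode encode-decode decode-encode

  digit-sums : ∀ (c : Fin n → Fin n × Fin n) →
               sumZZ m k n (encode ∘ c) ≡ sum (λ t → U (toℕ (proj₁ (c t)))) ∙ sum (λ t → V (toℕ (proj₂ (c t))))
  digit-sums c = trans (sumZZ≡sum m k n (encode ∘ c)) (∑-distrib-+ {n} (λ t → U (toℕ (proj₁ (c t)))) (λ t → V (toℕ (proj₂ (c t)))))

  digits⇒magicSquare : (d : Fin n × Fin n → Fin n × Fin n) → Bijective _≡_ _≡_ d → (μᵁ μⱽ : ZZ m k) →
                       (∀ ℓ → sum (λ t → U (toℕ (proj₁ (d (cell ℓ t))))) ≡ μᵁ) →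
                       (∀ ℓ → sum (λ t → V (toℕ (proj₂ (d (cell ℓ t))))) ≡ μⱽ) →
                       MagicSquare m k n
  digits⇒magicSquare d d-bijective μᵁ μⱽ U-lines V-lines =
    (λ i j → encode (d (i , j))) ,
    isMagicSquare-lines m k n _ (Composition.bijective _≡_ _≡_ _≡_ d-bijective encode-bijective) (μᵁ ∙ μⱽ)
      (λ ℓ → trans (digit-sums (d ∘ cell ℓ)) (cong₂ _∙_ (U-lines ℓ) (V-lines ℓ)))

outer : Fin 4 → Bool
outer 0F = true
outer 1F = false
outer 2F = false
outer 3F = true

outer-opposite : ∀ a → outer (opposite a) ≡ outer a
outer-opposite 0F = refl
outer-opposite 1F = refl
outer-opposite 2F = refl
outer-opposite 3F = refl

rim : ℕ → Bool
rim y = outer (y mod 4)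

-- _mod 4 is 4-periodic by computation, whence the last clause
rim-pair : ∀ q → rim (q * 2) ≡ not (rim (suc (q * 2)))
rim-pair 0             = refl
rim-pair 1             = refl
rim-pair (suc (suc q)) = rim-pair q

module DoublyEven (m k r t : ℕ) .{{_ : NonZero m}} .{{_ : NonZero k}} .{{_ : NonZero r}}
                  (n≡r*m : t * 2 * 2 ≡ r * m) (k≡r*n : k ≡ r * (t * 2 * 2)) where

  h n : ℕ
  h = t * 2
  n = h * 2

  open Encoding m k n r n≡r*m k≡r*n
  open CommutativeMonoid G using (_∙_; comm)
  open Sum G using (sum; sum-cong-≗)
  open Mult G using () renaming (_×_ to _·_)
  open ComplementarySums G

  rim-reverse : ∀ {y} → y < n → rim (n ∸ suc y) ≡ rim y
  rim-reverse {y} y<n = trans (cong outer reverse-mod4) (outer-opposite (y mod 4))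
    where
    n≡t*4 : n ≡ t * 4
    n≡t*4 = ℕ.*-assoc t 2 2
    reverse-mod4 : (n ∸ suc y) mod 4 ≡ opposite (y mod 4)
    reverse-mod4 = Modular.%≡toℕ⇒mod≡ 4 (n ∸ suc y) (begin
      (n ∸ suc y) % 4               ≡⟨ %-reverse {r = t} n≡t*4 y<n ⟩
      4 ∸ suc (y % 4)               ≡⟨ cong (λ z → 4 ∸ suc z) (Modular.toℕ-mod 4 y) ⟨
      4 ∸ suc (toℕ (y mod 4))       ≡⟨ opposite-prop (y mod 4) ⟨
      toℕ (opposite (y mod 4))      ∎)
      where open ≡-Reasoning

  -- true exactly off the two diagonals of the 4 × 4 block containing (x, y)
  flipped : ℕ → ℕ → Bool
  flipped x y = rim x xor rim y

  flipped-pairˡ : ∀ q y → flipped (q * 2) y ≡ not (flipped (suc (q * 2)) y)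
  flipped-pairˡ q y = trans (cong (_xor rim y) (rim-pair q)) (sym (not-distribˡ-xor (rim (suc (q * 2))) (rim y)))

  flipped-pairʳ : ∀ x q → flipped x (q * 2) ≡ not (flipped x (suc (q * 2)))
  flipped-pairʳ x q = trans (cong (rim x xor_) (rim-pair q)) (sym (not-distribʳ-xor (rim x) (rim (suc (q * 2)))))

  reflectIf : Bool → ℕ → ℕ
  reflectIf b x = if b then n ∸ suc x else x

  oppositeIf : Bool → Fin n → Fin n
  oppositeIf b a = if b then opposite a else a

  toℕ-oppositeIf : ∀ b a → toℕ (oppositeIf b a) ≡ reflectIf b (toℕ a)
  toℕ-oppositeIf true  a = opposite-prop a
  toℕ-oppositeIf false a = refl

  oppositeIf-involutive : ∀ b a → oppositeIf b (oppositeIf b a) ≡ a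
  oppositeIf-involutive true  a = opposite-involutive a
  oppositeIf-involutive false a = refl

  rim-oppositeIf : ∀ b a → rim (toℕ (oppositeIf b a)) ≡ rim (toℕ a)
  rim-oppositeIf true  a = trans (cong rim (opposite-prop a)) (rim-reverse (toℕ<n a))
  rim-oppositeIf false a = refl

  digits : Fin n × Fin n → Fin n × Fin n
  digits (i , j) = oppositeIf b i , oppositeIf b j
    where
    b : Bool
    b = flipped (toℕ i) (toℕ j)

  digits-involutive : ∀ ij → digits (digits ij) ≡ ij
  digits-involutive (i , j) = begin
    digits (digits (i , j))
      ≡⟨ cong (λ b′ → oppositeIf b′ (oppositeIf b i) , oppositeIf b′ (oppositeIf b j))
              (cong₂ _xor_ (rim-oppositeIf b i) (rim-oppositeIf b j)) ⟩
    oppositeIf b (oppositeIf b i) , oppositeIf b (oppositeIf b j)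
      ≡⟨ cong₂ _,_ (oppositeIf-involutive b i) (oppositeIf-involutive b j) ⟩
    i , j
      ∎
    where
    open ≡-Reasoning
    b : Bool
    b = flipped (toℕ i) (toℕ j)

  alternating-pair : ∀ {K φ x} → Complementary n K φ → x < n →
                     ∀ {b b′} → b ≡ not b′ → φ (reflectIf b x) ∙ φ (reflectIf b′ x) ≡ K
  alternating-pair {x = x} c x<n {b′ = true}  refl = c x x<n
  alternating-pair {φ = φ} {x} c x<n {b′ = false} refl = trans (comm (φ (n ∸ suc x)) (φ x)) (c x x<n)

  antidiagonal-unflipped : ∀ t → flipped (toℕ t) (toℕ (opposite t)) ≡ false
  antidiagonal-unflipped t = trans (cong (rim (toℕ t) xor_) (rim-oppositeIf true t)) (xor-same (rim (toℕ t)))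

  U-lines : ∀ ℓ → sum (λ t → U (toℕ (proj₁ (digits (cell ℓ t))))) ≡ h · Kᵁ
  U-lines (row i) =
    trans (sum-cong-≗ {n} (λ t → cong U (toℕ-oppositeIf (flipped (toℕ i) (toℕ t)) i)))
          (sumℕ-pairs h (λ y → U (reflectIf (flipped (toℕ i) y) (toℕ i)))
            (λ q _ → alternating-pair {φ = U} U-complementary (toℕ<n i) (flipped-pairʳ (toℕ i) q)))
  U-lines (col j) =
    trans (sum-cong-≗ {n} (λ t → cong U (toℕ-oppositeIf (flipped (toℕ t) (toℕ j)) t)))
          (complementary-sum-even h (λ x → U (reflectIf (flipped x (toℕ j)) x))
            (complementary-reflectIf U (λ x → flipped x (toℕ j))
              (λ x x<n → cong (_xor rim (toℕ j)) (rim-reverse x<n)) U-complementary))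
  U-lines diagonal =
    trans (sum-cong-≗ {n} (λ t → cong (λ b → U (toℕ (oppositeIf b t))) (xor-same (rim (toℕ t)))))
          (complementary-sum-even h U U-complementary)
  U-lines antidiagonal =
    trans (sum-cong-≗ {n} (λ t → cong (λ b → U (toℕ (oppositeIf b t))) (antidiagonal-unflipped t)))
          (complementary-sum-even h U U-complementary)

  V-lines : ∀ ℓ → sum (λ t → V (toℕ (proj₂ (digits (cell ℓ t))))) ≡ h · Kⱽ
  V-lines (row i) =
    trans (sum-cong-≗ {n} (λ t → cong V (toℕ-oppositeIf (flipped (toℕ i) (toℕ t)) t)))
          (complementary-sum-even h (λ y → V (reflectIf (flipped (toℕ i) y) y))
            (complementary-reflectIf V (flipped (toℕ i))
              (λ y y<n → cong (rim (toℕ i) xor_) (rim-reverse y<n)) V-complementary))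
  V-lines (col j) =
    trans (sum-cong-≗ {n} (λ t → cong V (toℕ-oppositeIf (flipped (toℕ t) (toℕ j)) j)))
          (sumℕ-pairs h (λ x → V (reflectIf (flipped x (toℕ j)) (toℕ j)))
            (λ q _ → alternating-pair {φ = V} V-complementary (toℕ<n j) (flipped-pairˡ q (toℕ j))))
  V-lines diagonal =
    trans (sum-cong-≗ {n} (λ t → cong (λ b → V (toℕ (oppositeIf b t))) (xor-same (rim (toℕ t)))))
          (complementary-sum-even h V V-complementary)
  V-lines antidiagonal =
    trans (sum-cong-≗ {n} (λ t → trans (cong (λ b → V (toℕ (oppositeIf b (opposite t)))) (antidiagonal-unflipped t))
                                       (cong V (opposite-prop t))))
          (complementary-sum-even h (λ x → V (n ∸ suc x))
            (complementary-reflectIf V (λ _ → true) (λ _ _ → refl) V-complementary))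

  square : MagicSquare m k n
  square = digits⇒magicSquare digits (bijective-inverse digits digits digits-involutive digits-involutive)
                              (h · Kᵁ) (h · Kⱽ) U-lines V-lines

module Odd (m k r h : ℕ) .{{_ : NonZero m}} .{{_ : NonZero k}} .{{_ : NonZero r}}
           (n≡r*m : suc (h * 2) ≡ r * m) (k≡r*n : k ≡ r * suc (h * 2)) where

  n : ℕ
  n = suc (h * 2)

  open Encoding m k n r n≡r*m k≡r*n
  open CommutativeMonoid G using (_∙_)
  open Sum G using (sum; sum-cong-≗; sum-replicate)
  open Mult G using () renaming (_×_ to _·_)
  open ComplementarySums G
  open Modular n using (toℕ-mod; mod-+; %≡toℕ⇒mod≡)
  open AbelianGroup (ℤ/ n) using (_-_; assoc; identityʳ; inverseʳ; group; commutativeSemigroup; commutativeMonoid)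
    renaming (_∙_ to _+ₙ_; _⁻¹ to -ₙ_; ε to 0ℤ)
  open import Algebra.Solver.CommutativeMonoid commutativeMonoid using (solve; _⊕_; _⊜_)
  open import Algebra.Properties.CommutativeSemigroup commutativeSemigroup using (interchange; x∙yz≈y∙xz)
  open import Algebra.Properties.AbelianGroup (ℤ/ n) using (xyx⁻¹≈y; ⁻¹-anti-homo‿-)
  open import Algebra.Properties.Group group using (//-rightDividesˡ; //-rightDividesʳ)

  -- halving is multiplication by (h + 1), the inverse of 2 modulo 2h + 1
  halve : Fin n → Fin n
  halve a = (toℕ a * suc h) mod n

  double-halve : ∀ a → halve a +ₙ halve a ≡ a
  double-halve a = begin
    halve a +ₙ halve a               ≡⟨ mod-+ (A * suc h) (A * suc h) ⟨
    (A * suc h + A * suc h) mod n    ≡⟨ cong (_mod n) (twice A h) ⟩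
    (A + A * n) mod n                ≡⟨ %≡toℕ⇒mod≡ (A + A * n) (trans ([m+kn]%n≡m%n A A n) (m<n⇒m%n≡m (toℕ<n a))) ⟩
    a                                ∎
    where
    open ≡-Reasoning
    A : ℕ
    A = toℕ a
    twice : ∀ A h → A * suc h + A * suc h ≡ A + A * suc (h * 2)
    twice = solve-∀

  halve-double : ∀ a → halve (a +ₙ a) ≡ a
  halve-double a = %≡toℕ⇒mod≡ (toℕ ((A + A) mod n) * suc h) (begin
    toℕ ((A + A) mod n) * suc h % n   ≡⟨ cong (λ x → x * suc h % n) (toℕ-mod (A + A)) ⟩
    (A + A) % n * suc h % n           ≡⟨ [m%n*o]%n≡[m*o]%n (A + A) (suc h) n ⟩
    (A + A) * suc h % n               ≡⟨ cong (_% n) (twice A h) ⟩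
    (A + A * n) % n                   ≡⟨ [m+kn]%n≡m%n A A n ⟩
    A % n                             ≡⟨ m<n⇒m%n≡m (toℕ<n a) ⟩
    A                                 ∎)
    where
    open ≡-Reasoning
    A : ℕ
    A = toℕ a
    twice : ∀ A h → (A + A) * suc h ≡ A + A * suc (h * 2)
    twice = solve-∀

  ω centre : Fin n
  ω      = fromℕ (h * 2)
  centre = fromℕ< (s≤s (ℕ.m≤m*n h 2))

  opposite≡ω- : ∀ t → opposite t ≡ ω - t
  opposite≡ω- t = trans (sym (//-rightDividesʳ t (opposite t))) (cong (_- t) opposite+t≡ω)
    where
    opposite+t≡ω : opposite t +ₙ t ≡ ω
    opposite+t≡ω = %≡toℕ⇒mod≡ (toℕ (opposite t) + toℕ t) (begin
      (toℕ (opposite t) + toℕ t) % n   ≡⟨ cong (λ x → (x + toℕ t) % n) (opposite-prop t) ⟩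
      (h * 2 ∸ toℕ t + toℕ t) % n      ≡⟨ cong (_% n) (ℕ.m∸n+n≡m (s≤s⁻¹ (toℕ<n t))) ⟩
      h * 2 % n                        ≡⟨ m<n⇒m%n≡m (ℕ.n<1+n (h * 2)) ⟩
      h * 2                            ≡⟨ toℕ-fromℕ (h * 2) ⟨
      toℕ ω                            ∎)
      where open ≡-Reasoning

  sum-translate : ∀ c (f : Fin n → ZZ m k) → sum (λ t → f (t +ₙ c)) ≡ sum f
  sum-translate c f = sum-∘-invertible f (_+ₙ c) (_- c) (//-rightDividesˡ c) (//-rightDividesʳ c)

  sum-reflect : ∀ c (f : Fin n → ZZ m k) → sum (λ t → f (c - t)) ≡ sum f
  sum-reflect c f = sum-∘-invertible f (c -_) (c -_) reflect-involutive reflect-involutive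
    where
    reflect-involutive : ∀ t → c - (c - t) ≡ t
    reflect-involutive t = trans (cong (c +ₙ_) (⁻¹-anti-homo‿- c t)) (trans (sym (assoc c t _)) (xyx⁻¹≈y c t))

  sum-double : ∀ (f : Fin n → ZZ m k) → sum (λ t → f (t +ₙ t)) ≡ sum f
  sum-double f = sum-∘-invertible f (λ t → t +ₙ t) halve double-halve halve-double

  sum-constant-centre : ∀ φ {K} → Complementary n K φ → sum {n} (λ _ → φ (toℕ centre)) ≡ sumℕ n φ
  sum-constant-centre φ c = begin
    sum {n} (λ _ → φ (toℕ centre))   ≡⟨ sum-replicate n ⟩
    n · φ (toℕ centre)               ≡⟨ cong (λ x → n · φ x) (toℕ-fromℕ< _) ⟩
    n · φ h                          ≡⟨ complementary-sum-centre h φ c ⟨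
    sumℕ n φ                         ∎
    where open ≡-Reasoning

  -- makes the V-digit on the antidiagonal constantly the centre (see antidiagonal-V)
  c₂ : Fin n
  c₂ = centre - ω

  digits : Fin n × Fin n → Fin n × Fin n
  digits (i , j) = (i +ₙ centre) - j , j +ₙ (i +ₙ c₂)

  antidiagonal-U : ∀ t → (t +ₙ centre) - opposite t ≡ (t +ₙ t) +ₙ c₂
  antidiagonal-U t = begin
    (t +ₙ centre) - opposite t         ≡⟨ cong (λ x → (t +ₙ centre) - x) (opposite≡ω- t) ⟩
    (t +ₙ centre) +ₙ -ₙ (ω - t)        ≡⟨ cong ((t +ₙ centre) +ₙ_) (⁻¹-anti-homo‿- ω t) ⟩
    (t +ₙ centre) +ₙ (t - ω)           ≡⟨ interchange t centre t (-ₙ ω) ⟩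
    (t +ₙ t) +ₙ c₂                     ∎
    where open ≡-Reasoning

  antidiagonal-V : ∀ t → opposite t +ₙ (t +ₙ c₂) ≡ centre
  antidiagonal-V t = begin
    opposite t +ₙ (t +ₙ c₂)            ≡⟨ cong (_+ₙ (t +ₙ c₂)) (opposite≡ω- t) ⟩
    (ω - t) +ₙ (t +ₙ c₂)               ≡⟨ assoc (ω - t) t c₂ ⟨
    ((ω - t) +ₙ t) +ₙ c₂               ≡⟨ cong (_+ₙ c₂) (//-rightDividesˡ t ω) ⟩
    ω +ₙ (centre - ω)                  ≡⟨ assoc ω centre (-ₙ ω) ⟨
    (ω +ₙ centre) - ω                  ≡⟨ xyx⁻¹≈y ω centre ⟩
    centre                             ∎
    where open ≡-Reasoning

  U-lines : ∀ ℓ → sum (λ t → U (toℕ (proj₁ (digits (cell ℓ t))))) ≡ sumℕ n U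
  U-lines (row i)      = sum-reflect (i +ₙ centre) (U ∘ toℕ)
  U-lines (col j)      = trans (sum-cong-≗ {n} (λ t → cong (U ∘ toℕ) (assoc t centre (-ₙ j))))
                               (sum-translate (centre - j) (U ∘ toℕ))
  U-lines diagonal     = trans (sum-cong-≗ {n} (λ t → cong (U ∘ toℕ) (xyx⁻¹≈y t centre)))
                               (sum-constant-centre U U-complementary)
  U-lines antidiagonal = trans (sum-cong-≗ {n} (λ t → cong (U ∘ toℕ) (antidiagonal-U t)))
                               (trans (sum-double (λ s → U (toℕ (s +ₙ c₂)))) (sum-translate c₂ (U ∘ toℕ)))

  V-lines : ∀ ℓ → sum (λ t → V (toℕ (proj₂ (digits (cell ℓ t))))) ≡ sumℕ n V
  V-lines (row i)      = sum-translate (i +ₙ c₂) (V ∘ toℕ)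
  V-lines (col j)      = trans (sum-cong-≗ {n} (λ t → cong (V ∘ toℕ) (x∙yz≈y∙xz j t c₂)))
                               (sum-translate (j +ₙ c₂) (V ∘ toℕ))
  V-lines diagonal     = trans (sum-cong-≗ {n} (λ t → cong (V ∘ toℕ) (sym (assoc t t c₂))))
                               (trans (sum-double (λ s → V (toℕ (s +ₙ c₂)))) (sum-translate c₂ (V ∘ toℕ)))
  V-lines antidiagonal = trans (sum-cong-≗ {n} (λ t → cong (V ∘ toℕ) (antidiagonal-V t)))
                               (sum-constant-centre V V-complementary)

  undigits : Fin n × Fin n → Fin n × Fin n
  undigits (z , w) = i , w - (i +ₙ c₂)
    where
    i : Fin n
    i = halve ((z +ₙ w) - (centre +ₙ c₂))

  undigits-digits : ∀ ij → undigits (digits ij) ≡ ij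
  undigits-digits (i , j) = begin
    undigits (digits (i , j))   ≡⟨ cong (λ i′ → i′ , w - (i′ +ₙ c₂)) (trans (cong halve z+w-C≡i+i) (halve-double i)) ⟩
    i , w - (i +ₙ c₂)           ≡⟨ cong (i ,_) (//-rightDividesʳ (i +ₙ c₂) j) ⟩
    i , j                       ∎
    where
    open ≡-Reasoning
    z w C : Fin n
    z = (i +ₙ centre) - j
    w = j +ₙ (i +ₙ c₂)
    C = centre +ₙ c₂
    z+w-C≡i+i : (z +ₙ w) - C ≡ i +ₙ i
    z+w-C≡i+i = begin
      (z +ₙ w) - C                                   ≡⟨ solve 6 (λ i c -j j c₂ -C → (((i ⊕ c) ⊕ -j) ⊕ (j ⊕ (i ⊕ c₂))) ⊕ -C
                                                                ⊜ (i ⊕ i) ⊕ ((j ⊕ -j) ⊕ ((c ⊕ c₂) ⊕ -C)))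
                                                              refl i centre (-ₙ j) j c₂ (-ₙ C) ⟩
      (i +ₙ i) +ₙ ((j - j) +ₙ (C - C))               ≡⟨ cong (λ x → (i +ₙ i) +ₙ x) (cong₂ _+ₙ_ (inverseʳ j) (inverseʳ C)) ⟩
      (i +ₙ i) +ₙ (0ℤ +ₙ 0ℤ)                          ≡⟨ cong ((i +ₙ i) +ₙ_) (identityʳ 0ℤ) ⟩
      (i +ₙ i) +ₙ 0ℤ                                  ≡⟨ identityʳ (i +ₙ i) ⟩
      i +ₙ i                                         ∎

  digits-undigits : ∀ zw → digits (undigits zw) ≡ zw
  digits-undigits (z , w) = cong₂ _,_ first (//-rightDividesˡ (i +ₙ c₂) w)
    where
    open ≡-Reasoning
    C i : Fin n
    C = centre +ₙ c₂
    i = halve ((z +ₙ w) - C)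
    first : (i +ₙ centre) - (w - (i +ₙ c₂)) ≡ z
    first = begin
      (i +ₙ centre) - (w - (i +ₙ c₂))       ≡⟨ cong ((i +ₙ centre) +ₙ_) (⁻¹-anti-homo‿- w (i +ₙ c₂)) ⟩
      (i +ₙ centre) +ₙ ((i +ₙ c₂) - w)      ≡⟨ solve 4 (λ i c c₂ -w → (i ⊕ c) ⊕ ((i ⊕ c₂) ⊕ -w) ⊜ ((i ⊕ i) ⊕ (c ⊕ c₂)) ⊕ -w)
                                                     refl i centre c₂ (-ₙ w) ⟩
      ((i +ₙ i) +ₙ C) - w                   ≡⟨ cong (λ x → (x +ₙ C) - w) (double-halve ((z +ₙ w) - C)) ⟩
      (((z +ₙ w) - C) +ₙ C) - w             ≡⟨ cong (_- w) (//-rightDividesˡ C (z +ₙ w)) ⟩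
      (z +ₙ w) - w                          ≡⟨ //-rightDividesʳ w z ⟩
      z                                     ∎

  square : MagicSquare m k n
  square = digits⇒magicSquare digits (bijective-inverse digits undigits digits-undigits undigits-digits)
                              (sumℕ n U) (sumℕ n V) U-lines V-lines

magicSquare-odd-or-doublyEven : ∀ (m k r n : ℕ) .{{_ : NonZero m}} .{{_ : NonZero k}} .{{_ : NonZero r}} →
                                n ≡ r * m → k ≡ r * n → n % 2 ≡ 1 ⊎ ∃[ t ] n ≡ t * 4 → MagicSquare m k n
magicSquare-odd-or-doublyEven m k r n n≡r*m k≡r*n (inj₁ n-odd) =
  subst (MagicSquare m k) (sym n≡) (Odd.square m k r (n / 2) (trans (sym n≡) n≡r*m) (trans k≡r*n (cong (r *_) n≡)))
  where
  n≡ : n ≡ suc (n / 2 * 2)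
  n≡ = trans (m≡m%n+[m/n]*n n 2) (cong (_+ n / 2 * 2) n-odd)
magicSquare-odd-or-doublyEven m k r n n≡r*m k≡r*n (inj₂ (t , n≡t*4)) =
  subst (MagicSquare m k) (sym n≡) (DoublyEven.square m k r t (trans (sym n≡) n≡r*m) (trans k≡r*n (cong (r *_) n≡)))
  where
  n≡ : n ≡ t * 2 * 2
  n≡ = trans n≡t*4 (sym (ℕ.*-assoc t 2 2))

prime-parity : ∀ {p} → Prime p → p ≡ 2 ⊎ p % 2 ≡ 1
prime-parity {p} pr with p % 2 in p%2 | m%n<n p 2
... | 0           | _ = inj₁ (two-divides (prime⇒irreducible pr (m%n≡0⇒n∣m p 2 p%2)))
  where
  two-divides : 2 ≡ 1 ⊎ 2 ≡ p → p ≡ 2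
  two-divides (inj₂ 2≡p) = sym 2≡p
... | 1           | _ = inj₂ refl
... | suc (suc _) | s≤s (s≤s ())

^-odd : ∀ {p} → p % 2 ≡ 1 → ∀ a → p ^ a % 2 ≡ 1
^-odd p-odd zero    = refl
^-odd {p} p-odd (suc a) = trans (%-distribˡ-* p (p ^ a) 2) (cong₂ (λ x y → x * y % 2) p-odd (^-odd p-odd a))

-- The bound |Γ| > 4 excludes exactly the side 2, which admits no magic square.
prime-power-parity : ∀ {p α} → Prime p → 4 < p ^ (2 * α) → p ^ α % 2 ≡ 1 ⊎ ∃[ t ] p ^ α ≡ t * 4
prime-power-parity {p} {α} pr 4<p^2α with prime-parity pr
... | inj₂ p-odd = inj₁ (^-odd p-odd α)
... | inj₁ refl  = inj₂ (doubly-even α 4<p^2α)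
  where
  doubly-even : ∀ α → 4 < 2 ^ (2 * α) → ∃[ t ] 2 ^ α ≡ t * 4
  doubly-even 0             (s≤s ())
  doubly-even 1             4<4 = contradiction 4<4 (ℕ.<-irrefl refl)
  doubly-even (suc (suc a)) _   = 2 ^ a , ×4 (2 ^ a)
    where
    ×4 : ∀ x → 2 * (2 * x) ≡ x * 4
    ×4 = solve-∀

power-factors : ∀ p {β γ α} → β ≤ γ → β + γ ≡ 2 * α →
                p ^ α ≡ p ^ (α ∸ β) * p ^ β × p ^ γ ≡ p ^ (α ∸ β) * p ^ α
power-factors p {β} {γ} {α} β≤γ β+γ≡2α =
  trans (cong (p ^_) (sym (ℕ.m∸n+n≡m β≤α))) (ℕ.^-distribˡ-+-* p (α ∸ β) β) ,
  trans (cong (p ^_) γ≡) (ℕ.^-distribˡ-+-* p (α ∸ β) α)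
  where
  2*α≡α+α : 2 * α ≡ α + α
  2*α≡α+α = cong (α +_) (ℕ.+-identityʳ α)
  β≤α : β ≤ α
  β≤α = ℕ.*-cancelˡ-≤ 2 (begin
    2 * β     ≡⟨ cong (β +_) (ℕ.+-identityʳ β) ⟩
    β + β     ≤⟨ ℕ.+-monoʳ-≤ β β≤γ ⟩
    β + γ     ≡⟨ β+γ≡2α ⟩
    2 * α     ∎)
    where open ℕ.≤-Reasoning
  γ≡ : γ ≡ α ∸ β + α
  γ≡ = ℕ.+-cancelˡ-≡ β γ (α ∸ β + α) (begin
    β + γ             ≡⟨ trans β+γ≡2α 2*α≡α+α ⟩
    α + α             ≡⟨ cong (_+ α) (ℕ.m+[n∸m]≡n β≤α) ⟨
    β + (α ∸ β) + α   ≡⟨ ℕ.+-assoc β (α ∸ β) α ⟩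
    β + (α ∸ β + α)   ∎)
    where open ≡-Reasoning

lemma4p10 : (p β γ α : ℕ) (pr : Prime p) → 1 ≤ β → β ≤ γ → β + γ ≡ 2 * α → 4 < p ^ (2 * α)
    → MagicSquare (p ^ β) (p ^ γ) {{m^n≢0 p β {{prime⇒nonZero pr}}}} {{m^n≢0 p γ {{prime⇒nonZero pr}}}} (p ^ α)
lemma4p10 p β γ α pr _ β≤γ β+γ≡2α 4<p^2α =
  magicSquare-odd-or-doublyEven (p ^ β) (p ^ γ) (p ^ (α ∸ β)) (p ^ α) {{m^n≢0 p β}} {{m^n≢0 p γ}} {{m^n≢0 p (α ∸ β)}}
    n≡r*m k≡r*n (prime-power-parity {α = α} pr 4<p^2α)
  where
  instance
    p-nonZero : NonZero p
    p-nonZero = prime⇒nonZero pr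
  n≡r*m : p ^ α ≡ p ^ (α ∸ β) * p ^ β
  n≡r*m = proj₁ (power-factors p β≤γ β+γ≡2α)
  k≡r*n : p ^ γ ≡ p ^ (α ∸ β) * p ^ α
  k≡r*n = proj₂ (power-factors p β≤γ β+γ≡2α)
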